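{- For every positive integer $i$, let $G_i$ be a finite $(2i+1)$-regular graph (without loops) with $\check s(G_i)=2i+2$. For every positive integer $k$, let $H_k$ be the disjoint union of $G_1,G_2,\dots,G_k$. Then $\Delta(H_k)=2k+1$ and $$\check s(H_k)=\sum_{i=1}^k \check s(G_i)=k^2+3k=\frac{\Delta(H_k)^2+4\Delta(H_k)-5}{4}.$$
   Context: $\Delta(H)$ denotes the maximum degree of $H$. An edge-coloring of a graph $H$ is a map $c\colon E(H)\to\{1,\dots,m\}$ (for some $m$) such that any two incident edges receive different colors. The palette of a vertex $v$ with respect to $c$ is $P_c(v)=\{c(e): e\in E(H) \text{ incident to } v\}$. The palette index $\check s(H)$ is the minimum, over all edge-colorings $c$ of $H$, of the number of distinct palettes among the vertices of $H$. -}

module Defs where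

open import Data.Nat using (ℕ; zero; suc; _+_; _*_; _⊔_; _≤_)
open import Data.Fin using (Fin; _↑ˡ_; _↑ʳ_; splitAt)
open import Data.Fin.Properties using (_≟_; ↑ˡ-injective; ↑ʳ-injective)
open import Data.List using (List; length; filter; map; foldr; allFin)
open import Data.Sum using (_⊎_; inj₁; inj₂)
open import Data.Product using (Σ; ∃-syntax; _×_; _,_)
open import Relation.Nullary using (¬_; Dec)
open import Relation.Nullary.Decidable using (_⊎-dec_)
open import Relation.Binary.PropositionalEquality using (_≡_; _≢_; refl; cong)

-- A finite graph without loops (parallel edges allowed):
-- vertices Fin order, edges Fin size, each edge has two distinct ends.
record Graph : Set where
  field
    order   : ℕ
    size    : ℕ
    end₁    : Fin size → Fin order
    end₂    : Fin size → Fin order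
    loopless : ∀ e → end₁ e ≢ end₂ e

open Graph public

Vertex : Graph → Set
Vertex G = Fin (order G)

Edge : Graph → Set
Edge G = Fin (size G)

Incident : (G : Graph) → Vertex G → Edge G → Set
Incident G v e = (end₁ G e ≡ v) ⊎ (end₂ G e ≡ v)

incident? : (G : Graph) → (v : Vertex G) → (e : Edge G) → Dec (Incident G v e)
incident? G v e = (end₁ G e ≟ v) ⊎-dec (end₂ G e ≟ v)

degree : (G : Graph) → Vertex G → ℕ
degree G v = length (filter (incident? G v) (allFin (size G)))

Regular : ℕ → Graph → Set
Regular d G = ∀ v → degree G v ≡ d

-- maximum degree Δ(G) (0 for the empty graph)
Δ : Graph → ℕ
Δ G = foldr _⊔_ 0 (map (degree G) (allFin (order G)))

IsEdgeColoring : (G : Graph) → (Edge G → ℕ) → Set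
IsEdgeColoring G c =
  ∀ e e′ → e ≢ e′ → (∃[ v ] (Incident G v e × Incident G v e′)) → c e ≢ c e′

InPalette : (G : Graph) → (Edge G → ℕ) → Vertex G → ℕ → Set
InPalette G c v x = ∃[ e ] (Incident G v e × c e ≡ x)

SamePalette : (G : Graph) → (Edge G → ℕ) → Vertex G → Vertex G → Set
SamePalette G c u v =
  ∀ x → (InPalette G c u x → InPalette G c v x) × (InPalette G c v x → InPalette G c u x)

-- the number of distinct palettes of c is at most t:
-- the vertices can be labelled with t labels so that equal labels force equal palettes
AtMostPalettes : (G : Graph) → (Edge G → ℕ) → ℕ → Set
AtMostPalettes G c t =
  Σ (Vertex G → Fin t) λ f → ∀ u v → f u ≡ f v → SamePalette G c u v

PaletteIndex : Graph → ℕ → Set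
PaletteIndex G s =
  (Σ (Edge G → ℕ) λ c → IsEdgeColoring G c × AtMostPalettes G c s)
  × (∀ (c : Edge G → ℕ) → IsEdgeColoring G c → ∀ t → AtMostPalettes G c t → s ≤ t)

private
  join : ∀ {A : Set} {m₁ m₂} → (Fin m₁ → A) → (Fin m₂ → A) → Fin (m₁ + m₂) → A
  join {m₁ = m₁} f g e with splitAt m₁ e
  ... | inj₁ a = f a
  ... | inj₂ b = g b

_⊕_ : Graph → Graph → Graph
G₁ ⊕ G₂ = record
  { order = order G₁ + order G₂
  ; size  = size G₁ + size G₂
  ; end₁  = λ e → sel₁ e
  ; end₂  = λ e → sel₂ e
  ; loopless = ll
  }
  where
  n₁ = order G₁
  n₂ = order G₂
  sel₁ : Fin (size G₁ + size G₂) → Fin (n₁ + n₂)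
  sel₁ e with splitAt (size G₁) e
  ... | inj₁ a = end₁ G₁ a ↑ˡ n₂
  ... | inj₂ b = n₁ ↑ʳ end₁ G₂ b
  sel₂ : Fin (size G₁ + size G₂) → Fin (n₁ + n₂)
  sel₂ e with splitAt (size G₁) e
  ... | inj₁ a = end₂ G₁ a ↑ˡ n₂
  ... | inj₂ b = n₁ ↑ʳ end₂ G₂ b
  ll : ∀ e → sel₁ e ≢ sel₂ e
  ll e with splitAt (size G₁) e
  ... | inj₁ a = λ eq → loopless G₁ a (↑ˡ-injective n₂ _ _ eq)
  ... | inj₂ b = λ eq → loopless G₂ b (↑ʳ-injective n₁ _ _ eq)

emptyGraph : Graph
emptyGraph = record { order = 0 ; size = 0 ; end₁ = λ () ; end₂ = λ () ; loopless = λ () }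

unionUpTo : (ℕ → Graph) → ℕ → Graph
unionUpTo G zero    = emptyGraph
unionUpTo G (suc k) = unionUpTo G k ⊕ G (suc k)

sumFrom1 : (ℕ → ℕ) → ℕ → ℕ
sumFrom1 f zero    = 0
sumFrom1 f (suc k) = sumFrom1 f k + f (suc k)

-- In an edge colouring the palette of a vertex has exactly as many colours as
-- the vertex has edges, so vertices with equal palettes have equal degrees.
-- The blocks G i have the pairwise distinct degrees 2i+1, hence no palette is
-- shared between blocks and the palette index is additive: optimal colourings
-- of the blocks combine into a colouring of the union, and conversely any
-- colouring of the union restricts to each block G i, where it must already use
-- at least š(G i) palettes, all of them private to that block.

module Submission where

open import Defs
open import Data.Nat using (ℕ; zero; suc; _+_; _*_; _≤_; _<_; z≤n; s≤s)
open import Data.Nat.Properties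
  using (≤-refl; ≤-reflexive; ≤-trans; ≤-antisym; +-suc; +-mono-≤;
         ⊔-lub; m≤n⇒m≤n⊔o; m≤n⇒m≤o⊔n;
         m≤n⇒m≤1+n; <⇒≱; n<1+n; +-monoˡ-<; *-monoʳ-<; module ≤-Reasoning)
open import Data.Nat.Tactic.RingSolver using (solve-∀)
open import Data.Fin using (Fin; zero; suc; _↑ˡ_; _↑ʳ_; splitAt)
open import Data.Fin.Properties
  using (_≟_; any?; ¬Fin0; injective⇒≤; ↑ˡ-injective; ↑ʳ-injective;
         splitAt-↑ˡ; splitAt-↑ʳ; splitAt⁻¹-↑ˡ; splitAt⁻¹-↑ʳ)
open import Data.List using (List; []; _∷_; length; filter; allFin; lookup)
open import Data.List.Properties using (foldr-preservesᵇ; foldr-preservesᵒ; length-tabulate)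
open import Data.List.Membership.Propositional.Properties using (∈-filter⁺; ∈-filter⁻; ∈-allFin; ∈-lookup)
open import Data.List.Relation.Unary.All as All using ()
open import Data.List.Relation.Unary.All.Properties as All using ()
open import Data.List.Relation.Unary.Any as Any using ()
open import Data.List.Relation.Unary.Any.Properties as Any using (lookup-index)
open import Data.List.Relation.Unary.Unique.Propositional using (Unique)
open import Data.List.Relation.Unary.AllPairs using (_∷_)
open import Data.List.Relation.Unary.Unique.Propositional.Properties as Unique using ()
open import Data.Vec.Functional using (_++_)
open import Data.Vec.Functional.Properties using (lookup-++ˡ; lookup-++ʳ)
open import Data.Sum using (_⊎_; inj₁; inj₂; [_,_])
import Data.Sum as Sum
open import Data.Product using (Σ; ∃-syntax; _×_; _,_; proj₁; proj₂; swap)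
open import Data.Empty using (⊥-elim)
open import Function using (_∘_)
open import Level using (0ℓ)
open import Relation.Nullary using (¬_; yes; no)
open import Relation.Unary using (Pred; Decidable)
open import Relation.Binary.PropositionalEquality
  using (_≡_; _≢_; _≗_; refl; sym; trans; cong; subst)

lookup-injective : ∀ {A : Set} {xs : List A} → Unique xs →
                   ∀ {k l} → lookup xs k ≡ lookup xs l → k ≡ l
lookup-injective (_ ∷ _)      {zero}  {zero}  _  = refl
lookup-injective (x≢xs ∷ _)   {zero}  {suc l} eq = ⊥-elim (All.lookup x≢xs (∈-lookup l) eq)
lookup-injective (x≢xs ∷ _)   {suc k} {zero}  eq = ⊥-elim (All.lookup x≢xs (∈-lookup k) (sym eq))
lookup-injective (_ ∷ unique) {suc k} {suc l} eq = cong suc (lookup-injective unique eq)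

module _ {n : ℕ} {P : Pred (Fin n) 0ℓ} (P? : Decidable P) where

  count : ℕ
  count = length (filter P? (allFin n))

  rank : ∀ {i} → P i → Fin count
  rank {i} p = Any.index (∈-filter⁺ P? (∈-allFin i) p)

  select : Fin count → Fin n
  select = lookup (filter P? (allFin n))

  rank-injective : ∀ {i j} (p : P i) (q : P j) → rank p ≡ rank q → i ≡ j
  rank-injective {i} {j} p q eq =
    trans (lookup-index (∈-filter⁺ P? (∈-allFin i) p))
          (trans (cong select eq) (sym (lookup-index (∈-filter⁺ P? (∈-allFin j) q))))

  select-satisfies : ∀ k → P (select k)
  select-satisfies k = proj₂ (∈-filter⁻ P? {xs = allFin n} (∈-lookup k))

  select-injective : ∀ {k l} → select k ≡ select l → k ≡ l
  select-injective = lookup-injective (Unique.filter⁺ P? (Unique.allFin⁺ n))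

count-mono : ∀ {m n} {P : Pred (Fin m) 0ℓ} {Q : Pred (Fin n) 0ℓ}
             (P? : Decidable P) (Q? : Decidable Q)
             (φ : ∀ {i} → P i → Σ (Fin n) Q) →
             (∀ {i j} (p : P i) (q : P j) → proj₁ (φ p) ≡ proj₁ (φ q) → i ≡ j) →
             count P? ≤ count Q?
count-mono P? Q? φ φ-injective = injective⇒≤ {f = embed} embed-injective
  where
  embed : Fin (count P?) → Fin (count Q?)
  embed k = rank Q? (proj₂ (φ (select-satisfies P? k)))

  embed-injective : ∀ {k l} → embed k ≡ embed l → k ≡ l
  embed-injective eq = select-injective P?
    (φ-injective _ _ (rank-injective Q? (proj₂ (φ _)) (proj₂ (φ _)) eq))

module _ {A : Set} {P Q : Pred A 0ℓ} (P? : Decidable P) (Q? : Decidable Q)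
         (disjoint : ∀ {x} → P x → ¬ Q x) where

  length-filter-disjoint : ∀ xs → length (filter P? xs) + length (filter Q? xs) ≤ length xs
  length-filter-disjoint []       = z≤n
  length-filter-disjoint (x ∷ xs) with P? x | Q? x | length-filter-disjoint xs
  ... | yes p | yes q | _  = ⊥-elim (disjoint p q)
  ... | yes _ | no _  | ih = s≤s ih
  ... | no _  | yes _ | ih = ≤-trans (≤-reflexive (+-suc _ _)) (s≤s ih)
  ... | no _  | no _  | ih = m≤n⇒m≤1+n ih

count-disjoint : ∀ {n} {P Q : Pred (Fin n) 0ℓ} (P? : Decidable P) (Q? : Decidable Q) →
                 (∀ {i} → P i → ¬ Q i) → count P? + count Q? ≤ n
count-disjoint {n} P? Q? disjoint =
  ≤-trans (length-filter-disjoint P? Q? disjoint (allFin n)) (≤-reflexive (length-tabulate _))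

Image : ∀ {m t} → (Fin m → Fin t) → Pred (Fin t) 0ℓ
Image f ℓ = ∃[ i ] f i ≡ ℓ

image? : ∀ {m t} (f : Fin m → Fin t) → Decidable (Image f)
image? f ℓ = any? (λ i → f i ≟ ℓ)

compress : ∀ {m t} (f : Fin m → Fin t) → Fin m → Fin (count (image? f))
compress f i = rank (image? f) (i , refl)

compress-injective : ∀ {m t} (f : Fin m → Fin t) {i j} → compress f i ≡ compress f j → f i ≡ f j
compress-injective f = rank-injective (image? f) _ _

↑ˡ≢↑ʳ : ∀ {m n} {i : Fin m} {j : Fin n} → i ↑ˡ n ≢ m ↑ʳ j
↑ˡ≢↑ʳ {m} {n} {i} {j} eq
  with trans (sym (splitAt-↑ˡ m i n)) (trans (cong (splitAt m) eq) (splitAt-↑ʳ m n j))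
... | ()

data Split (m n : ℕ) : Fin (m + n) → Set where
  left  : (i : Fin m) → Split m n (i ↑ˡ n)
  right : (j : Fin n) → Split m n (m ↑ʳ j)

split : ∀ m n (i : Fin (m + n)) → Split m n i
split m n i with splitAt m i in eq
... | inj₁ j = subst (Split m n) (splitAt⁻¹-↑ˡ eq) (left j)
... | inj₂ j = subst (Split m n) (splitAt⁻¹-↑ʳ eq) (right j)

Fin-inhabited⊎empty : ∀ n → Fin n ⊎ (Fin n → Fin 0)
Fin-inhabited⊎empty zero    = inj₂ (λ ())
Fin-inhabited⊎empty (suc _) = inj₁ zero

module _ (G : Graph) where

  degree≤Δ : ∀ v → degree G v ≤ Δ G
  degree≤Δ v =
    foldr-preservesᵒ {P = degree G v ≤_} (λ x y → [ m≤n⇒m≤n⊔o y , m≤n⇒m≤o⊔n x ]) 0 _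
    (inj₂ (Any.map⁺ (Any.tabulate⁺ v ≤-refl)))

  Δ-lub : ∀ {d} → (∀ v → degree G v ≤ d) → Δ G ≤ d
  Δ-lub bound = foldr-preservesᵇ {P = _≤ _} ⊔-lub z≤n (All.map⁺ (All.tabulate⁺ bound))

  -- Distinct edges at u have distinct colours, so matching each of them with
  -- the edge of the same colour at v is injective.
  samePalette⇒degree≤ : ∀ {c u v} → IsEdgeColoring G c → SamePalette G c u v →
                        degree G u ≤ degree G v
  samePalette⇒degree≤ {c} {u} {v} coloring same =
    count-mono (incident? G u) (incident? G v) partner partner-injective
    where
    partner : ∀ {e} → Incident G u e → Σ (Edge G) (Incident G v)
    partner {e} p = let (e′ , q , _) = proj₁ (same (c e)) (e , p , refl) in e′ , q

    same-colour : ∀ {e} (p : Incident G u e) → c (proj₁ (partner p)) ≡ c e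
    same-colour {e} p = proj₂ (proj₂ (proj₁ (same (c e)) (e , p , refl)))

    partner-injective : ∀ {e e′} (p : Incident G u e) (p′ : Incident G u e′) →
                        proj₁ (partner p) ≡ proj₁ (partner p′) → e ≡ e′
    partner-injective {e} {e′} p p′ eq with e ≟ e′
    ... | yes e≡e′ = e≡e′
    ... | no e≢e′  = ⊥-elim (coloring e e′ e≢e′ (u , p , p′)
      (trans (sym (same-colour p)) (trans (cong c eq) (same-colour p′))))

  samePalette⇒degree≡ : ∀ {c u v} → IsEdgeColoring G c → SamePalette G c u v →
                        degree G u ≡ degree G v
  samePalette⇒degree≡ coloring same =
    ≤-antisym (samePalette⇒degree≤ coloring same) (samePalette⇒degree≤ coloring (swap ∘ same))

  samePalette-≗ : ∀ {c c′ u v} → c ≗ c′ → SamePalette G c u v → SamePalette G c′ u v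
  samePalette-≗ {c} {c′} c≗c′ same x =
    recolour ∘ proj₁ (same x) ∘ uncolour , recolour ∘ proj₂ (same x) ∘ uncolour
    where
    recolour : ∀ {w} → InPalette G c w x → InPalette G c′ w x
    recolour (e , p , eq) = e , p , trans (sym (c≗c′ e)) eq
    uncolour : ∀ {w} → InPalette G c′ w x → InPalette G c w x
    uncolour (e , p , eq) = e , p , trans (c≗c′ e) eq

  isEdgeColoring-≗ : ∀ {c c′} → c ≗ c′ → IsEdgeColoring G c → IsEdgeColoring G c′
  isEdgeColoring-≗ c≗c′ coloring e e′ e≢e′ shared eq =
    coloring e e′ e≢e′ shared (trans (c≗c′ e) (trans eq (sym (c≗c′ e′))))

  paletteIndex-suc⇒vertex : ∀ {s} → PaletteIndex G (suc s) → Vertex G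
  paletteIndex-suc⇒vertex ((c , coloring , _) , minimal) with Fin-inhabited⊎empty (order G)
  ... | inj₁ v = v
  ... | inj₂ none with minimal c coloring 0 (none , λ u → ⊥-elim (¬Fin0 (none u)))
  ...   | ()

-- By `edge-at`, A sits inside H as a union of connected components.
record ComponentEmbedding (A H : Graph) : Set where
  field
    vertex           : Vertex A → Vertex H
    edge             : Edge A → Edge H
    vertex-injective : ∀ {u v} → vertex u ≡ vertex v → u ≡ v
    edge-injective   : ∀ {e e′} → edge e ≡ edge e′ → e ≡ e′
    end₁-edge        : ∀ e → end₁ H (edge e) ≡ vertex (end₁ A e)
    end₂-edge        : ∀ e → end₂ H (edge e) ≡ vertex (end₂ A e)
    edge-at          : ∀ {v e} → Incident H (vertex v) e → ∃[ a ] edge a ≡ e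

module ComponentEmbeddingProperties {A H : Graph} (ι : ComponentEmbedding A H) where
  open ComponentEmbedding ι

  incident⁺ : ∀ {v e} → Incident A v e → Incident H (vertex v) (edge e)
  incident⁺ {e = e} = Sum.map (trans (end₁-edge e) ∘ cong vertex) (trans (end₂-edge e) ∘ cong vertex)

  incident⁻ : ∀ {v e} → Incident H (vertex v) (edge e) → Incident A v e
  incident⁻ {e = e} = Sum.map (vertex-injective ∘ trans (sym (end₁-edge e)))
                              (vertex-injective ∘ trans (sym (end₂-edge e)))

  preimage : ∀ {v e} → Incident H (vertex v) e → Σ (Edge A) (Incident A v)
  preimage {v} p = let (a , eq) = edge-at p in a , incident⁻ (subst (Incident H (vertex v)) (sym eq) p)

  degree-vertex : ∀ v → degree H (vertex v) ≡ degree A v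
  degree-vertex v = ≤-antisym
    (count-mono (incident? H (vertex v)) (incident? A v) preimage
      λ p q eq → trans (sym (proj₂ (edge-at p))) (trans (cong edge eq) (proj₂ (edge-at q))))
    (count-mono (incident? A v) (incident? H (vertex v)) (λ {e} p → edge e , incident⁺ p)
      λ _ _ → edge-injective)

  inPalette⁺ : ∀ {c w x} → InPalette A (c ∘ edge) w x → InPalette H c (vertex w) x
  inPalette⁺ (a , p , eq) = edge a , incident⁺ p , eq

  inPalette⁻ : ∀ {c w x} → InPalette H c (vertex w) x → InPalette A (c ∘ edge) w x
  inPalette⁻ {c} (e , p , eq) =
    proj₁ (preimage p) , proj₂ (preimage p) , trans (cong c (proj₂ (edge-at p))) eq

  samePalette⁺ : ∀ {c u v} → SamePalette A (c ∘ edge) u v → SamePalette H c (vertex u) (vertex v)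
  samePalette⁺ {c} same x =
    inPalette⁺ {c} ∘ proj₁ (same x) ∘ inPalette⁻ , inPalette⁺ {c} ∘ proj₂ (same x) ∘ inPalette⁻

  samePalette⁻ : ∀ {c u v} → SamePalette H c (vertex u) (vertex v) → SamePalette A (c ∘ edge) u v
  samePalette⁻ {c} same x =
    inPalette⁻ ∘ proj₁ (same x) ∘ inPalette⁺ {c} , inPalette⁻ ∘ proj₂ (same x) ∘ inPalette⁺ {c}

  atMostPalettes-restrict : ∀ {c t} (f : Vertex H → Fin t) → (∀ u v → f u ≡ f v → SamePalette H c u v) →
                            AtMostPalettes A (c ∘ edge) (count (image? (f ∘ vertex)))
  atMostPalettes-restrict f same =
    compress (f ∘ vertex) , λ u v eq → samePalette⁻ (same _ _ (compress-injective (f ∘ vertex) eq))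

  isEdgeColoring-restrict : ∀ {c} → IsEdgeColoring H c → IsEdgeColoring A (c ∘ edge)
  isEdgeColoring-restrict coloring e e′ e≢e′ (v , p , p′) =
    coloring (edge e) (edge e′) (e≢e′ ∘ edge-injective) (vertex v , incident⁺ p , incident⁺ p′)

  proper-at-vertex : ∀ {c v e e′} → IsEdgeColoring A (c ∘ edge) → e ≢ e′ →
                     Incident H (vertex v) e → Incident H (vertex v) e′ → c e ≢ c e′
  proper-at-vertex {v = v} coloring e≢e′ p p′ with edge-at p | edge-at p′
  ... | a , refl | a′ , refl = coloring a a′ (e≢e′ ∘ cong edge) (v , incident⁻ p , incident⁻ p′)

module _ (A B : Graph) where

  end₁-↑ˡ : ∀ e → end₁ (A ⊕ B) (e ↑ˡ size B) ≡ end₁ A e ↑ˡ order B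
  end₁-↑ˡ e rewrite splitAt-↑ˡ (size A) e (size B) = refl

  end₂-↑ˡ : ∀ e → end₂ (A ⊕ B) (e ↑ˡ size B) ≡ end₂ A e ↑ˡ order B
  end₂-↑ˡ e rewrite splitAt-↑ˡ (size A) e (size B) = refl

  end₁-↑ʳ : ∀ e → end₁ (A ⊕ B) (size A ↑ʳ e) ≡ order A ↑ʳ end₁ B e
  end₁-↑ʳ e rewrite splitAt-↑ʳ (size A) (size B) e = refl

  end₂-↑ʳ : ∀ e → end₂ (A ⊕ B) (size A ↑ʳ e) ≡ order A ↑ʳ end₂ B e
  end₂-↑ʳ e rewrite splitAt-↑ʳ (size A) (size B) e = refl

  edge-at-↑ˡ : ∀ {v e} → Incident (A ⊕ B) (v ↑ˡ order B) e → ∃[ a ] a ↑ˡ size B ≡ e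
  edge-at-↑ˡ {e = e} p with split (size A) (size B) e
  ... | left a  = a , refl
  ... | right b = ⊥-elim ([ (λ eq → ↑ˡ≢↑ʳ (trans (sym eq) (end₁-↑ʳ b)))
                          , (λ eq → ↑ˡ≢↑ʳ (trans (sym eq) (end₂-↑ʳ b))) ] p)

  edge-at-↑ʳ : ∀ {v e} → Incident (A ⊕ B) (order A ↑ʳ v) e → ∃[ b ] size A ↑ʳ b ≡ e
  edge-at-↑ʳ {e = e} p with split (size A) (size B) e
  ... | right b = b , refl
  ... | left a  = ⊥-elim ([ (λ eq → ↑ˡ≢↑ʳ (trans (sym (end₁-↑ˡ a)) eq))
                          , (λ eq → ↑ˡ≢↑ʳ (trans (sym (end₂-↑ˡ a)) eq)) ] p)

  inl : ComponentEmbedding A (A ⊕ B)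
  inl = record
    { vertex           = _↑ˡ order B
    ; edge             = _↑ˡ size B
    ; vertex-injective = ↑ˡ-injective (order B) _ _
    ; edge-injective   = ↑ˡ-injective (size B) _ _
    ; end₁-edge        = end₁-↑ˡ
    ; end₂-edge        = end₂-↑ˡ
    ; edge-at          = edge-at-↑ˡ
    }

  inr : ComponentEmbedding B (A ⊕ B)
  inr = record
    { vertex           = order A ↑ʳ_
    ; edge             = size A ↑ʳ_
    ; vertex-injective = ↑ʳ-injective (order A) _ _
    ; edge-injective   = ↑ʳ-injective (size A) _ _
    ; end₁-edge        = end₁-↑ʳ
    ; end₂-edge        = end₂-↑ʳ
    ; edge-at          = edge-at-↑ʳ
    }

  module Left  = ComponentEmbeddingProperties inl
  module Right = ComponentEmbeddingProperties inr

  isEdgeColoring-++ : ∀ {cA cB} → IsEdgeColoring A cA → IsEdgeColoring B cB →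
                      IsEdgeColoring (A ⊕ B) (cA ++ cB)
  isEdgeColoring-++ {cA} {cB} colA colB e e′ e≢e′ (v , p , p′) with split (order A) (order B) v
  ... | left _  = Left.proper-at-vertex (isEdgeColoring-≗ A (sym ∘ lookup-++ˡ cA cB) colA) e≢e′ p p′
  ... | right _ = Right.proper-at-vertex (isEdgeColoring-≗ B (sym ∘ lookup-++ʳ cA cB) colB) e≢e′ p p′

  atMostPalettes-++ : ∀ {cA cB a b} → AtMostPalettes A cA a → AtMostPalettes B cB b →
                      AtMostPalettes (A ⊕ B) (cA ++ cB) (a + b)
  atMostPalettes-++ {cA} {cB} {a} {b} (fA , sameA) (fB , sameB) = label , same
    where
    label : Vertex (A ⊕ B) → Fin (a + b)
    label = (λ u → fA u ↑ˡ b) ++ (λ w → a ↑ʳ fB w)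

    label-↑ˡ : ∀ u → label (u ↑ˡ order B) ≡ fA u ↑ˡ b
    label-↑ˡ = lookup-++ˡ (λ u → fA u ↑ˡ b) (λ w → a ↑ʳ fB w)

    label-↑ʳ : ∀ w → label (order A ↑ʳ w) ≡ a ↑ʳ fB w
    label-↑ʳ = lookup-++ʳ (λ u → fA u ↑ˡ b) (λ w → a ↑ʳ fB w)

    same : ∀ x y → label x ≡ label y → SamePalette (A ⊕ B) (cA ++ cB) x y
    same x y eq with split (order A) (order B) x | split (order A) (order B) y
    ... | left u  | left v  = Left.samePalette⁺ (samePalette-≗ A (sym ∘ lookup-++ˡ cA cB)
      (sameA u v (↑ˡ-injective b _ _ (trans (sym (label-↑ˡ u)) (trans eq (label-↑ˡ v))))))
    ... | right u | right v = Right.samePalette⁺ (samePalette-≗ B (sym ∘ lookup-++ʳ cA cB)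
      (sameB u v (↑ʳ-injective a _ _ (trans (sym (label-↑ʳ u)) (trans eq (label-↑ʳ v))))))
    ... | left u  | right w = ⊥-elim (↑ˡ≢↑ʳ (trans (sym (label-↑ˡ u)) (trans eq (label-↑ʳ w))))
    ... | right w | left u  = ⊥-elim (↑ˡ≢↑ʳ (trans (sym (label-↑ˡ u)) (trans (sym eq) (label-↑ʳ w))))

  paletteIndex-⊕ : ∀ {a b} → PaletteIndex A a → PaletteIndex B b →
                   (∀ c → IsEdgeColoring (A ⊕ B) c → ∀ u w →
                      ¬ SamePalette (A ⊕ B) c (u ↑ˡ order B) (order A ↑ʳ w)) →
                   PaletteIndex (A ⊕ B) (a + b)
  paletteIndex-⊕ {a} {b} ((cA , colA , palA) , minA) ((cB , colB , palB) , minB) separated =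
    (cA ++ cB , isEdgeColoring-++ colA colB , atMostPalettes-++ palA palB) , minimal
    where
    minimal : ∀ c → IsEdgeColoring (A ⊕ B) c → ∀ t → AtMostPalettes (A ⊕ B) c t → a + b ≤ t
    minimal c coloring t (f , same) = begin
      a + b
        ≤⟨ +-mono-≤ (minA _ (Left.isEdgeColoring-restrict coloring) _ (Left.atMostPalettes-restrict f same))
                    (minB _ (Right.isEdgeColoring-restrict coloring) _ (Right.atMostPalettes-restrict f same)) ⟩
      count (image? (f ∘ (_↑ˡ order B))) + count (image? (f ∘ (order A ↑ʳ_)))
        ≤⟨ count-disjoint (image? _) (image? _) disjoint ⟩
      t ∎
      where
      open ≤-Reasoning
      disjoint : ∀ {ℓ} → Image (f ∘ (_↑ˡ order B)) ℓ → ¬ Image (f ∘ (order A ↑ʳ_)) ℓ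
      disjoint (u , refl) (w , eq) = separated c coloring u w (same _ _ (sym eq))

2k+1<2[1+k]+1 : ∀ k → 2 * k + 1 < 2 * suc k + 1
2k+1<2[1+k]+1 k = +-monoˡ-< 1 (*-monoʳ-< 2 (n<1+n k))

sum[2i+2] : ∀ k → sumFrom1 (λ i → 2 * i + 2) k ≡ k * k + 3 * k
sum[2i+2] zero    = refl
sum[2i+2] (suc k) = trans (cong (_+ (2 * suc k + 2)) (sum[2i+2] k)) (step k)
  where
  step : ∀ k → k * k + 3 * k + (2 * suc k + 2) ≡ suc k * suc k + 3 * suc k
  step = solve-∀

4[k²+3k]+5≡[2k+1]²+4[2k+1] : ∀ k → 4 * (k * k + 3 * k) + 5 ≡ (2 * k + 1) * (2 * k + 1) + 4 * (2 * k + 1)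
4[k²+3k]+5≡[2k+1]²+4[2k+1] = solve-∀

module Blocks (G : ℕ → Graph)
              (regular : ∀ i → 1 ≤ i → Regular (2 * i + 1) (G i))
              (index : ∀ i → 1 ≤ i → PaletteIndex (G i) (2 * i + 2)) where

  U : ℕ → Graph
  U = unionUpTo G

  degree-last-block : ∀ k w → degree (U (suc k)) (order (U k) ↑ʳ w) ≡ 2 * suc k + 1
  degree-last-block k w = trans (Right.degree-vertex (U k) (G (suc k)) w) (regular (suc k) (s≤s z≤n) w)

  degree-U≤ : ∀ k v → degree (U k) v ≤ 2 * k + 1
  degree-U≤ (suc k) v with split (order (U k)) (order (G (suc k))) v
  ... | left u  = begin
    degree (U (suc k)) (u ↑ˡ order (G (suc k))) ≡⟨ Left.degree-vertex (U k) (G (suc k)) u ⟩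
    degree (U k) u                                ≤⟨ degree-U≤ k u ⟩
    2 * k + 1                                     <⟨ 2k+1<2[1+k]+1 k ⟩
    2 * suc k + 1                                 ∎
    where open ≤-Reasoning
  ... | right w = ≤-reflexive (degree-last-block k w)

  blocks-separated : ∀ k c → IsEdgeColoring (U (suc k)) c → ∀ u w →
                     ¬ SamePalette (U (suc k)) c (u ↑ˡ order (G (suc k))) (order (U k) ↑ʳ w)
  blocks-separated k c coloring u w same = <⇒≱ (2k+1<2[1+k]+1 k) (begin
    2 * suc k + 1                                 ≡⟨ sym (degree-last-block k w) ⟩
    degree (U (suc k)) (order (U k) ↑ʳ w)         ≡⟨ sym (samePalette⇒degree≡ (U (suc k)) coloring same) ⟩
    degree (U (suc k)) (u ↑ˡ order (G (suc k)))   ≡⟨ Left.degree-vertex (U k) (G (suc k)) u ⟩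
    degree (U k) u                                ≤⟨ degree-U≤ k u ⟩
    2 * k + 1                                     ∎)
    where open ≤-Reasoning

  paletteIndex-U : ∀ k → PaletteIndex (U k) (sumFrom1 (λ i → 2 * i + 2) k)
  paletteIndex-U zero    = ((λ ()) , (λ ()) , (λ ()) , (λ ())) , λ _ _ _ _ → z≤n
  paletteIndex-U (suc k) =
    paletteIndex-⊕ (U k) (G (suc k)) (paletteIndex-U k) (index (suc k) (s≤s z≤n)) (blocks-separated k)

  -- The hypothesis š > 0 is what makes the last block nonempty, so that Δ is attained there.
  Δ-U : ∀ k → Δ (U (suc k)) ≡ 2 * suc k + 1
  Δ-U k = ≤-antisym (Δ-lub (U (suc k)) (degree-U≤ (suc k))) (begin
    2 * suc k + 1                          ≡⟨ sym (degree-last-block k w) ⟩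
    degree (U (suc k)) (order (U k) ↑ʳ w)  ≤⟨ degree≤Δ (U (suc k)) _ ⟩
    Δ (U (suc k))                          ∎)
    where
    open ≤-Reasoning
    w = paletteIndex-suc⇒vertex (G (suc k)) (index (suc k) (s≤s z≤n))

mainTheorem4 : (G : ℕ → Graph)
    → (∀ i → 1 ≤ i → Regular (2 * i + 1) (G i))
    → (∀ i → 1 ≤ i → PaletteIndex (G i) (2 * i + 2))
    → ∀ k → 1 ≤ k
    → (Δ (unionUpTo G k) ≡ 2 * k + 1)
      × PaletteIndex (unionUpTo G k) (sumFrom1 (λ i → 2 * i + 2) k)
      × (sumFrom1 (λ i → 2 * i + 2) k ≡ k * k + 3 * k)
      × (4 * (k * k + 3 * k) + 5 ≡ Δ (unionUpTo G k) * Δ (unionUpTo G k) + 4 * Δ (unionUpTo G k))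
mainTheorem4 G regular index (suc k) (s≤s z≤n) =
  Δ-U k , paletteIndex-U (suc k) , sum[2i+2] (suc k) ,
  subst (λ d → 4 * (suc k * suc k + 3 * suc k) + 5 ≡ d * d + 4 * d) (sym (Δ-U k))
        (4[k²+3k]+5≡[2k+1]²+4[2k+1] (suc k))
  where open Blocks G regular index
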